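{- Let $\mathbb{K}$ be an infinite field, let $\ell\geq 3$, let $\mathcal{H}=(V,E)$ be a connected $\ell$-uniform hypergraph, and let $\delta\in\mathrm{Der}(\mathcal{H},U)$. Then for all $a,b\in[\ell]$, the function $\delta_a-\delta_b:V\to\mathbb{K}$ is constant (i.e. lies in the span of the constant function $\mathbf{1}$).
   Context: Notation: $[\ell]=\{1,\dots,\ell\}$, $\mathrm{Sym}(\ell)$ is the symmetric group on $[\ell]$; for $f\in Y^{[\ell]}$ and $\sigma\in\mathrm{Sym}(\ell)$, $f^{\sigma}(a)=f(a^{\sigma})$. An $\ell$-uniform hypergraph is a pair $\mathcal{H}=(V,E)$ of finite sets where $E$ is a set of orbits of $V^{\ell}$ (functions $[\ell]\to V$) under this action; an edge $e$ is regarded via a representative as an element of $V^{\ell}$, with $e^{\sigma}$ the other elements of its orbit. $\mathcal{H}$ is connected if any two vertices $x,y$ are joined by a walk $x=x_1,e_1,x_2,\dots,e_{m-1},x_m=y$ with, for each $i$, $e_i(a_i)=x_i$ and $e_i(b_i)=x_{i+1}$ for some $a_i,b_i\in[\ell]$. $U:\mathbb{K}^{\ell}\to\mathbb{K}$ is $U(\lambda)=\lambda(1)+\cdots+\lambda(\ell)$. A $U$-signal of $\mathcal{H}$ is a function $\delta:[\ell]\to\mathbb{K}^V$, $a\mapsto\delta_a$, such that for all $e\in E$ and $\sigma\in\mathrm{Sym}(\ell)$, $\sum_{a\in[\ell]}\delta_a(e^{\sigma}(a))=0$; $\mathrm{Der}(\mathcal{H},U)$ is the set of $U$-signals. -}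

module Defs where

open import Level using (Level; _⊔_) renaming (suc to lsuc)
open import Data.Nat using (ℕ; zero; suc)
open import Data.Fin using (Fin) renaming (zero to fzero; suc to fsuc)
open import Data.List using (List)
open import Data.List.Membership.Propositional using (_∈_)
open import Data.List.Relation.Unary.All using (All)
open import Data.Product using (Σ; ∃; _×_; _,_)
open import Data.Fin.Permutation using (Permutation′; _⟨$⟩ʳ_)
open import Relation.Binary.PropositionalEquality using (_≡_)
open import Relation.Binary.Construct.Closure.ReflexiveTransitive using (Star)
open import Relation.Nullary using (¬_)
open import Algebra.Bundles using (CommutativeRing)

record Field (c ℓ : Level) : Set (lsuc (c ⊔ ℓ)) where
  field
    commutativeRing : CommutativeRing c ℓ
  open CommutativeRing commutativeRing public
  field
    1≉0     : ¬ (1# ≈ 0#)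
    inverse : ∀ x → ¬ (x ≈ 0#) → ∃ λ y → (x * y) ≈ 1#

Infinite : ∀ {c ℓ} → Field c ℓ → Set (c ⊔ ℓ)
Infinite K = ∀ (xs : List Carrier) → ∃ λ x → All (λ y → ¬ (x ≈ y)) xs
  where open Field K

-- An ℓ-uniform hypergraph on vertex set V = Fin n; the edge set E (a set of
-- Sym(ℓ)-orbits of V^[ℓ]) is given by a list of orbit representatives e : Fin ℓ → Fin n.
record Hypergraph (ℓ : ℕ) : Set where
  field
    n     : ℕ
    edges : List (Fin ℓ → Fin n)

_^_ : ∀ {ℓ} {V : Set} → (Fin ℓ → V) → Permutation′ ℓ → (Fin ℓ → V)
(e ^ σ) a = e (σ ⟨$⟩ʳ a)

module _ {ℓ : ℕ} (H : Hypergraph ℓ) where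
  open Hypergraph H

  Step : Fin n → Fin n → Set
  Step x y = Σ (Fin ℓ → Fin n) λ e → e ∈ edges × ∃ λ a → ∃ λ b → e a ≡ x × e b ≡ y

  Connected : Set
  Connected = ∀ (x y : Fin n) → Star Step x y

module _ {c r : Level} (K : Field c r) where
  open Field K

  Σ[_] : ∀ {ℓ} → (Fin ℓ → Carrier) → Carrier
  Σ[_] {zero}  f = 0#
  Σ[_] {suc ℓ} f = f fzero + Σ[_] (λ a → f (fsuc a))

  IsUSignal : ∀ {ℓ} (H : Hypergraph ℓ) → (Fin ℓ → Fin (Hypergraph.n H) → Carrier) → Set r
  IsUSignal {ℓ} H δ = ∀ e → e ∈ Hypergraph.edges H → ∀ (σ : Permutation′ ℓ) →
    Σ[_] (λ a → δ a ((e ^ σ) a)) ≈ 0#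

-- Fix positions a ≠ b, an edge e and σ ∈ Sym(ℓ). The signal equations for e^σ and for
-- e^((a b)σ) differ only in the terms at a and b, so subtracting them gives
-- δ_a(x) + δ_b(y) = δ_a(y) + δ_b(x) with x = e(σ a), y = e(σ b), i.e. δ_a − δ_b takes the
-- same value at x and y. As σ ranges over Sym(ℓ), (x, y) ranges over all pairs of vertices
-- of e, so δ_a − δ_b is constant along walks, hence constant on a connected hypergraph.
module Submission where

open import Defs
open import Level using (Level)
open import Data.Nat using (ℕ; _≤_)
open import Data.Fin using (Fin)
open import Data.Product using (∃)

open import Data.Nat using (zero; suc)
open import Data.Fin using (zero; suc)
open import Data.Fin.Properties using (_≟_; suc-injective)
open import Data.Fin.Permutation using (Permutation′; _⟨$⟩ʳ_; transpose; _∘ₚ_)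
import Data.Fin.Permutation.Components as PC
open import Data.List.Membership.Propositional using (_∈_)
open import Data.Maybe using (nothing)
open import Data.Product using (_×_; _,_)
open import Data.Empty using (⊥-elim)
open import Function using (_∘_)
open import Relation.Nullary using (yes; no)
open import Relation.Binary.PropositionalEquality
  using (_≡_; _≢_; refl; trans; cong; subst₂)
open import Relation.Binary.Construct.Closure.ReflexiveTransitive using (Star; ε; _◅_)
open import Algebra.Properties.Group using (x∙y⁻¹≈ε⇒x≈y)
open import Algebra.Properties.AbelianGroup using (⁻¹-anti-homo‿-)
open import Algebra.Bundles using (CommutativeRing)
open import Tactic.RingSolver using (solve-∀)
open import Tactic.RingSolver.Core.AlmostCommutativeRing
  using (AlmostCommutativeRing; fromCommutativeRing)

transpose-matchˡ : ∀ {n} (i j : Fin n) → PC.transpose i j i ≡ j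
transpose-matchˡ i j with i ≟ i
... | yes _   = refl
... | no i≢i = ⊥-elim (i≢i refl)

transpose-matchʳ : ∀ {n} (i j : Fin n) → PC.transpose i j j ≡ i
transpose-matchʳ i j with j ≟ i
... | yes j≡i = j≡i
... | no _ with j ≟ j
...   | yes _   = refl
...   | no j≢j = ⊥-elim (j≢j refl)

transpose-noMatch : ∀ {n} {i j k : Fin n} → k ≢ i → k ≢ j → PC.transpose i j k ≡ k
transpose-noMatch {i = i} {j} {k} k≢i k≢j with k ≟ i
... | yes k≡i = ⊥-elim (k≢i k≡i)
... | no _ with k ≟ j
...   | yes k≡j = ⊥-elim (k≢j k≡j)
...   | no _    = refl

pair-permutation : ∀ {n} {a b a′ b′ : Fin n} → a ≢ b → a′ ≢ b′ →
                   ∃ λ (σ : Permutation′ n) → σ ⟨$⟩ʳ a ≡ a′ × σ ⟨$⟩ʳ b ≡ b′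
pair-permutation {a = a} {b} {a′} {b′} a≢b a′≢b′ = σ , σa≡a′ , transpose-matchˡ c b′
  where
  c : Fin _
  c = PC.transpose a a′ b

  σ : Permutation′ _
  σ = transpose a a′ ∘ₚ transpose c b′

  a′≢c : a′ ≢ c
  a′≢c a′≡c = a≢b (begin
    a                                       ≡⟨ transpose-matchˡ a′ a ⟨
    PC.transpose a′ a a′                    ≡⟨ cong (PC.transpose a′ a) a′≡c ⟩
    PC.transpose a′ a (PC.transpose a a′ b) ≡⟨ PC.transpose-inverse a′ a ⟩
    b                                       ∎)
    where open Relation.Binary.PropositionalEquality.≡-Reasoning

  σa≡a′ : σ ⟨$⟩ʳ a ≡ a′
  σa≡a′ = trans (cong (PC.transpose c b′) (transpose-matchˡ a a′)) (transpose-noMatch a′≢c a′≢b′)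

module _ {c r : Level} (R : CommutativeRing c r) where
  private
    ring : AlmostCommutativeRing c r
    ring = fromCommutativeRing R (λ _ → nothing)
  open AlmostCommutativeRing ring

  -‿+-interchange : ∀ w x y z → (w - x) + (y - z) ≈ (w + y) - (x + z)
  -‿+-interchange = solve-∀ ring

  -‿+-exchange : ∀ w x y z → (w - x) + (y - z) ≈ (w - z) + (y - x)
  -‿+-exchange = solve-∀ ring

module _ {c r : Level} (K : Field c r) where
  open Field K hiding (zero) renaming (refl to ≈-refl; sym to ≈-sym; trans to ≈-trans)
  open import Relation.Binary.Reasoning.Setoid setoid

  Σ-zero : ∀ {m} (f : Fin m → Carrier) → (∀ i → f i ≈ 0#) → Σ[ K ] f ≈ 0#
  Σ-zero {zero}  f f≈0 = ≈-refl
  Σ-zero {suc m} f f≈0 = ≈-trans (+-cong (f≈0 zero) (Σ-zero (f ∘ suc) (f≈0 ∘ suc))) (+-identityˡ 0#)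

  Σ-single : ∀ {m} (f : Fin m → Carrier) a → (∀ i → i ≢ a → f i ≈ 0#) → Σ[ K ] f ≈ f a
  Σ-single {suc m} f zero f≈0 =
    ≈-trans (+-cong ≈-refl (Σ-zero (f ∘ suc) (λ i → f≈0 (suc i) λ ()))) (+-identityʳ _)
  Σ-single {suc m} f (suc a) f≈0 =
    ≈-trans (+-cong (f≈0 zero λ ())
                    (Σ-single (f ∘ suc) a (λ i i≢a → f≈0 (suc i) (i≢a ∘ suc-injective))))
            (+-identityˡ _)

  Σ-pair : ∀ {m} (f : Fin m → Carrier) a b → a ≢ b → (∀ i → i ≢ a → i ≢ b → f i ≈ 0#) →
           Σ[ K ] f ≈ f a + f b
  Σ-pair {suc m} f zero zero a≢b f≈0 = ⊥-elim (a≢b refl)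
  Σ-pair {suc m} f zero (suc b) a≢b f≈0 =
    +-cong ≈-refl (Σ-single (f ∘ suc) b (λ i i≢b → f≈0 (suc i) (λ ()) (i≢b ∘ suc-injective)))
  Σ-pair {suc m} f (suc a) zero a≢b f≈0 =
    ≈-trans (+-cong ≈-refl
                    (Σ-single (f ∘ suc) a (λ i i≢a → f≈0 (suc i) (i≢a ∘ suc-injective) (λ ()))))
            (+-comm _ _)
  Σ-pair {suc m} f (suc a) (suc b) a≢b f≈0 =
    ≈-trans (+-cong (f≈0 zero (λ ()) (λ ()))
                    (Σ-pair (f ∘ suc) a b (a≢b ∘ cong suc)
                            (λ i i≢a i≢b → f≈0 (suc i) (i≢a ∘ suc-injective) (i≢b ∘ suc-injective))))
            (+-identityˡ _)

  Σ-sub : ∀ {m} (f g : Fin m → Carrier) → Σ[ K ] (λ i → f i - g i) ≈ Σ[ K ] f - Σ[ K ] g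
  Σ-sub {zero}  f g = ≈-sym (-‿inverseʳ 0#)
  Σ-sub {suc m} f g =
    ≈-trans (+-cong ≈-refl (Σ-sub (f ∘ suc) (g ∘ suc))) (-‿+-interchange commutativeRing _ _ _ _)

  swap-balanced : ∀ {ℓ} {V : Set} (δ : Fin ℓ → V → Carrier) (p : Fin ℓ → V) {a b} → a ≢ b →
                  Σ[ K ] (λ i → δ i (p i)) ≈ 0# →
                  Σ[ K ] (λ i → δ i (p (PC.transpose a b i))) ≈ 0# →
                  δ a (p a) - δ b (p a) ≈ δ a (p b) - δ b (p b)
  swap-balanced δ p {a} {b} a≢b Σf≈0 Σg≈0 = x∙y⁻¹≈ε⇒x≈y +-group _ _ (begin
    (δ a (p a) - δ b (p a)) - (δ a (p b) - δ b (p b)) ≈⟨ +-cong ≈-refl (⁻¹-anti-homo‿- +-abelianGroup _ _) ⟩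
    (δ a (p a) - δ b (p a)) + (δ b (p b) - δ a (p b)) ≈⟨ -‿+-exchange commutativeRing _ _ _ _ ⟩
    (δ a (p a) - δ a (p b)) + (δ b (p b) - δ b (p a)) ≡⟨ d-a+d-b ⟨
    d a + d b                                          ≈⟨ Σ-pair d a b a≢b d-off ⟨
    Σ[ K ] d                                           ≈⟨ Σ-sub f g ⟩
    Σ[ K ] f - Σ[ K ] g                                ≈⟨ +-cong Σf≈0 (-‿cong Σg≈0) ⟩
    0# - 0#                                            ≈⟨ -‿inverseʳ 0# ⟩
    0#                                                 ∎)
    where
    f g d : Fin _ → Carrier
    f i = δ i (p i)
    g i = δ i (p (PC.transpose a b i))
    d i = f i - g i

    d-off : ∀ i → i ≢ a → i ≢ b → d i ≈ 0#
    d-off i i≢a i≢b rewrite transpose-noMatch i≢a i≢b = -‿inverseʳ (f i)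

    d-a+d-b : d a + d b ≡ (δ a (p a) - δ a (p b)) + (δ b (p b) - δ b (p a))
    d-a+d-b rewrite transpose-matchˡ a b | transpose-matchʳ a b = refl

  pairwise-equal⇒constant : ∀ {n} (g : Fin n → Carrier) → (∀ v w → g v ≈ g w) →
                            ∃ λ c → ∀ v → g v ≈ c
  pairwise-equal⇒constant {zero}  g g≈ = 0# , λ ()
  pairwise-equal⇒constant {suc n} g g≈ = g zero , λ v → g≈ v zero

  module _ {ℓ} (H : Hypergraph ℓ) {δ : Fin ℓ → Fin (Hypergraph.n H) → Carrier}
           (δ-signal : IsUSignal K H δ) {a b : Fin ℓ} (a≢b : a ≢ b) where
    open Hypergraph H

    Δ : Fin n → Carrier
    Δ v = δ a v - δ b v

    difference-constant-on-edge : ∀ {e} → e ∈ edges → ∀ a′ b′ → Δ (e a′) ≈ Δ (e b′)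
    difference-constant-on-edge {e} e∈E a′ b′ with a′ ≟ b′
    ... | yes refl = ≈-refl
    ... | no a′≢b′ with pair-permutation a≢b a′≢b′
    ...   | σ , σa≡a′ , σb≡b′ =
      subst₂ (λ x y → Δ x ≈ Δ y) (cong e σa≡a′) (cong e σb≡b′)
             (swap-balanced δ (e ^ σ) a≢b (δ-signal e e∈E σ) (δ-signal e e∈E (transpose a b ∘ₚ σ)))

    difference-constant-along-walk : ∀ {x y} → Star (Step H) x y → Δ x ≈ Δ y
    difference-constant-along-walk ε = ≈-refl
    difference-constant-along-walk ((e , e∈E , a′ , b′ , refl , refl) ◅ walk) =
      ≈-trans (difference-constant-on-edge e∈E a′ b′) (difference-constant-along-walk walk)

lemma5p3 : ∀ {c r : Level} (K : Field c r) → Infinite K →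
    ∀ (ℓ : ℕ) → 3 ≤ ℓ → (H : Hypergraph ℓ) → Connected H →
    (δ : Fin ℓ → Fin (Hypergraph.n H) → Field.Carrier K) → IsUSignal K H δ →
    ∀ (a b : Fin ℓ) → ∃ λ (c : Field.Carrier K) →
      ∀ (v : Fin (Hypergraph.n H)) → Field._≈_ K (Field._-_ K (δ a v) (δ b v)) c
lemma5p3 K _ _ _ H connected δ δ-signal a b with a ≟ b
... | yes refl = Field.0# K , λ v → Field.-‿inverseʳ K (δ a v)
... | no a≢b   = pairwise-equal⇒constant K (Δ K H δ-signal a≢b)
                   λ v w → difference-constant-along-walk K H δ-signal a≢b (connected v w)
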